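{- If $m\ge 0$ is even and $r\ge0$, then $$\tilde A(r) \le \sum_{k=0}^{2^r-1} t(2^rm+k) < A(r).$$
   Context: The Stern sequence $(s(n))_{n\ge0}$ is defined by $s(0)=0$, $s(1)=1$, $s(2n)=s(n)$, $s(2n+1)=s(n)+s(n+1)$; $s(n+1)\ge 1$ for all $n\ge0$. Let $t(n)=s(n)/s(n+1)$. For $r\ge0$ define $A(r)=\sum_{n=2^r}^{2^{r+1}-1} t(n)$ and $\tilde A(r)=\sum_{n=0}^{2^r-1} t(n)$. -}

module Defs where

open import Data.Nat using (ℕ; zero; suc; pred; _+_; _*_; _^_)
open import Data.Nat.DivMod using (_/_; _%_)
open import Data.List using (List; map; upTo)
open import Data.Integer using (+_)
open import Data.Rational using (ℚ; 0ℚ)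
import Data.Rational as ℚ

-- Stern sequence, computed with fuel (fuel n+1 ≥ needed depth since n halves each step).
sternF : ℕ → ℕ → ℕ
sternF zero    n = 0
sternF (suc f) 0 = 0
sternF (suc f) 1 = 1
sternF (suc f) (suc (suc k)) with (suc (suc k)) % 2
... | 0 = sternF f ((suc (suc k)) / 2)
... | _ = sternF f ((suc (suc k)) / 2) + sternF f ((suc (suc k)) / 2 + 1)

s : ℕ → ℕ
s n = sternF (suc n) n

-- t(n) = s(n)/s(n+1).  Since s(n+1) ≥ 1 for all n, s(n+1) = suc (pred (s(n+1))),
-- so the denominator below is exactly s(n+1).
t : ℕ → ℚ
t n = (+ s n) ℚ./ suc (pred (s (suc n)))

sumFrom : ℕ → ℕ → (ℕ → ℚ) → ℚ
sumFrom a zero      f = 0ℚ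
sumFrom a (suc len) f = f a ℚ.+ sumFrom (suc a) len f

A : ℕ → ℚ
A r = sumFrom (2 ^ r) (2 ^ r) t

Ã : ℕ → ℚ
Ã r = sumFrom 0 (2 ^ r) t

{-# OPTIONS --safe #-}
-- The tree n ↦ 2n, 2n+1 below m has the block [2^r m, 2^r (m+1)) as its r-th
-- generation, and by s(2n) = s(n), s(2n+1) = s(n) + s(n+1) a node with
-- t(n) = a/b has children with t-values a/(a+b) and (a+b)/b: this is the
-- Calkin–Wilf tree.  So the block sum is a function of the pair (s m, s(m+1))
-- alone, and it is increasing (strictly) in s m / s(m+1) because both child maps
-- are.  Ã(r), the block of an even m = 2q, and A(r) are its values at
-- 0/1 ≤ s q/(s q + s(q+1)) < 1/1.
module Submission where

open import Defs
open import Data.Nat using (ℕ; zero; suc; pred; _+_; _*_; _^_; _≤_; _<_; z≤n; s≤s; s≤s⁻¹)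
open import Data.Nat.Properties
open import Data.Nat.DivMod using (_/_; m*n%n≡0; m*n/n≡m; [m+kn]%n≡m%n; +-distrib-/)
open import Data.Nat.Divisibility using (_∣_; divides)
open import Data.Nat.Induction using (<-rec)
open import Data.Nat.Tactic.RingSolver using (solve-∀)
open import Data.Product using (_×_; _,_)
open import Data.Integer using (ℤ; +_)
import Data.Integer as ℤ
import Data.Integer.Properties as ℤ
open import Data.Rational using (ℚ)
import Data.Rational as ℚ
import Data.Rational.Properties as ℚ
import Data.Rational.Unnormalised as ℚᵘ
import Data.Rational.Unnormalised.Properties as ℚᵘ
open import Relation.Binary.PropositionalEquality

data EvenOdd : ℕ → Set where
  even : ∀ k → EvenOdd (k * 2)
  odd  : ∀ k → EvenOdd (suc (k * 2))

evenOdd : ∀ n → EvenOdd n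
evenOdd zero = even 0
evenOdd (suc n) with evenOdd n
... | even k = odd k
... | odd  k = even (suc k)

sternF-even : ∀ f k → sternF (suc f) (suc k * 2) ≡ sternF f (suc k)
sternF-even f k rewrite m*n%n≡0 (suc k) 2 ⦃ _ ⦄ | m*n/n≡m (suc k) 2 ⦃ _ ⦄ = refl

[1+k*2]/2≡k : ∀ k → suc (k * 2) / 2 ≡ k
[1+k*2]/2≡k k = begin
  (1 + k * 2) / 2    ≡⟨ +-distrib-/ 1 (k * 2) (subst (λ x → 1 + x < 2) (sym (m*n%n≡0 k 2)) ≤-refl) ⟩
  1 / 2 + k * 2 / 2  ≡⟨ m*n/n≡m k 2 ⟩
  k                  ∎
  where open ≡-Reasoning

sternF-odd : ∀ f k → sternF (suc f) (suc (suc k * 2)) ≡ sternF f (suc k) + sternF f (suc (suc k))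
sternF-odd f k rewrite [m+kn]%n≡m%n 1 (suc k) 2 ⦃ _ ⦄ | [1+k*2]/2≡k (suc k) =
  cong (λ n → sternF f (suc k) + sternF f n) (+-comm (suc k) 1)

sternF-fuel : ∀ f g n → n < f → n < g → sternF f n ≡ sternF g n
sternF-fuel (suc f) (suc g) n n<f n<g with evenOdd n
... | even zero    = refl
... | odd  zero    = refl
... | even (suc k) = begin
  sternF (suc f) (suc k * 2)  ≡⟨ sternF-even f k ⟩
  sternF f (suc k)            ≡⟨ sternF-fuel f g (suc k) (half n<f) (half n<g) ⟩
  sternF g (suc k)            ≡⟨ sternF-even g k ⟨
  sternF (suc g) (suc k * 2)  ∎
  where
  open ≡-Reasoning
  half : ∀ {h} → suc k * 2 < suc h → suc k < h
  half p = <-≤-trans (s≤s (s≤s (m≤m*n k 2))) (s≤s⁻¹ p)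
... | odd (suc k) = begin
  sternF (suc f) (suc (suc k * 2))            ≡⟨ sternF-odd f k ⟩
  sternF f (suc k) + sternF f (suc (suc k))  ≡⟨ cong₂ _+_ (sternF-fuel f g (suc k) (<⇒≤ (half n<f)) (<⇒≤ (half n<g)))
                                                          (sternF-fuel f g (suc (suc k)) (half n<f) (half n<g)) ⟩
  sternF g (suc k) + sternF g (suc (suc k))  ≡⟨ sternF-odd g k ⟨
  sternF (suc g) (suc (suc k * 2))            ∎
  where
  open ≡-Reasoning
  half : ∀ {h} → suc (suc k * 2) < suc h → suc (suc k) < h
  half p = <-≤-trans (s≤s (s≤s (s≤s (m≤m*n k 2)))) (s≤s⁻¹ p)

s-even : ∀ k → s (k * 2) ≡ s k
s-even zero    = refl
s-even (suc k) = trans (sternF-even _ k) (sternF-fuel _ _ (suc k) (s≤s (s≤s (m≤m*n k 2))) ≤-refl)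

s-odd : ∀ k → s (suc (k * 2)) ≡ s k + s (suc k)
s-odd zero    = refl
s-odd (suc k) = trans (sternF-odd _ k)
  (cong₂ _+_ (sternF-fuel _ _ (suc k) (s≤s (s≤s (m≤n⇒m≤1+n (m≤m*n k 2)))) ≤-refl)
             (sternF-fuel _ _ (suc (suc k)) (s≤s (s≤s (s≤s (m≤m*n k 2)))) ≤-refl))

s-suc-positive : ∀ n → 0 < s (suc n)
s-suc-positive = <-rec _ step
  where
  step : ∀ n → (∀ {m} → m < n → 0 < s (suc m)) → 0 < s (suc n)
  step n ih with evenOdd n
  ... | even zero    = ≤-refl
  ... | even (suc k) = begin-strict
    0                         <⟨ ih (s≤s (s≤s (m≤m*n k 2))) ⟩
    s (suc (suc k))           ≤⟨ m≤n+m _ _ ⟩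
    s (suc k) + s (suc (suc k)) ≡⟨ s-odd (suc k) ⟨
    s (suc (suc k * 2))       ∎
    where open ≤-Reasoning
  ... | odd k = subst (0 <_) (sym (s-even (suc k))) (ih (s≤s (m≤m*n k 2)))

sumFrom-+ : ∀ a p q (f : ℕ → ℚ) → sumFrom a (p + q) f ≡ sumFrom a p f ℚ.+ sumFrom (a + p) q f
sumFrom-+ a zero    q f rewrite +-identityʳ a = sym (ℚ.+-identityˡ _)
sumFrom-+ a (suc p) q f rewrite sumFrom-+ (suc a) p q f | +-suc a p = sym (ℚ.+-assoc (f a) _ _)

-- The denominator is written as in t, so that generation 0 at (s n, s (n + 1)) is t n by definition.
calkinWilfSum : ℕ → ℕ → ℕ → ℚ
calkinWilfSum zero    a b = + a ℚ./ suc (pred b)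
calkinWilfSum (suc r) a b = calkinWilfSum r a (a + b) ℚ.+ calkinWilfSum r (a + b) b

sumFrom-t-block : ∀ r m → sumFrom (2 ^ r * m) (2 ^ r) t ≡ calkinWilfSum r (s m) (s (suc m))
sumFrom-t-block zero    m rewrite *-identityˡ m = ℚ.+-identityʳ _
sumFrom-t-block (suc r) m = begin
  sumFrom (2 ^ suc r * m) (2 ^ suc r) t
    ≡⟨ cong₂ (λ a n → sumFrom a n t) (leftHalf-start (2 ^ r) m) (halves (2 ^ r)) ⟩
  sumFrom (2 ^ r * (m * 2)) (2 ^ r + 2 ^ r) t
    ≡⟨ sumFrom-+ _ (2 ^ r) (2 ^ r) t ⟩
  sumFrom (2 ^ r * (m * 2)) (2 ^ r) t ℚ.+ sumFrom (2 ^ r * (m * 2) + 2 ^ r) (2 ^ r) t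
    ≡⟨ cong (λ a → sumFrom (2 ^ r * (m * 2)) (2 ^ r) t ℚ.+ sumFrom a (2 ^ r) t) (rightHalf-start (2 ^ r) m) ⟩
  sumFrom (2 ^ r * (m * 2)) (2 ^ r) t ℚ.+ sumFrom (2 ^ r * suc (m * 2)) (2 ^ r) t
    ≡⟨ cong₂ ℚ._+_ (sumFrom-t-block r (m * 2)) (sumFrom-t-block r (suc (m * 2))) ⟩
  calkinWilfSum r (s (m * 2)) (s (suc (m * 2))) ℚ.+ calkinWilfSum r (s (suc (m * 2))) (s (suc m * 2))
    ≡⟨ cong₂ ℚ._+_ (cong₂ (calkinWilfSum r) (s-even m) (s-odd m)) (cong₂ (calkinWilfSum r) (s-odd m) (s-even (suc m))) ⟩
  calkinWilfSum (suc r) (s m) (s (suc m))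
    ∎
  where
  open ≡-Reasoning
  leftHalf-start : ∀ x m → 2 * x * m ≡ x * (m * 2)
  leftHalf-start = solve-∀
  halves : ∀ x → 2 * x ≡ x + x
  halves = solve-∀
  rightHalf-start : ∀ x m → x * (m * 2) + x ≡ x * suc (m * 2)
  rightHalf-start = solve-∀

cross-≤⇒/-≤ : ∀ (p q : ℤ) b d → p ℤ.* + suc d ℤ.≤ q ℤ.* + suc b → p ℚ./ suc b ℚ.≤ q ℚ./ suc d
cross-≤⇒/-≤ p q b d h = ℚ.toℚᵘ-cancel-≤
  (ℚᵘ.≤-respˡ-≃ (ℚᵘ.≃-sym (ℚ.toℚᵘ-fromℚᵘ (ℚᵘ.mkℚᵘ p b)))
  (ℚᵘ.≤-respʳ-≃ (ℚᵘ.≃-sym (ℚ.toℚᵘ-fromℚᵘ (ℚᵘ.mkℚᵘ q d))) (ℚᵘ.*≤* h)))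

cross-<⇒/-< : ∀ (p q : ℤ) b d → p ℤ.* + suc d ℤ.< q ℤ.* + suc b → p ℚ./ suc b ℚ.< q ℚ./ suc d
cross-<⇒/-< p q b d h = ℚ.toℚᵘ-cancel-<
  (ℚᵘ.<-respˡ-≃ (ℚᵘ.≃-sym (ℚ.toℚᵘ-fromℚᵘ (ℚᵘ.mkℚᵘ p b)))
  (ℚᵘ.<-respʳ-≃ (ℚᵘ.≃-sym (ℚ.toℚᵘ-fromℚᵘ (ℚᵘ.mkℚᵘ q d))) (ℚᵘ.*<* h)))

module _ (a b c d : ℕ) where

  leftChild-mono-≤ : a * d ≤ c * b → a * (c + d) ≤ c * (a + b)
  leftChild-mono-≤ h = begin
    a * (c + d)    ≡⟨ *-distribˡ-+ a c d ⟩
    a * c + a * d  ≤⟨ +-monoʳ-≤ (a * c) h ⟩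
    a * c + c * b  ≡⟨ cong (_+ c * b) (*-comm a c) ⟩
    c * a + c * b  ≡⟨ *-distribˡ-+ c a b ⟨
    c * (a + b)    ∎
    where open ≤-Reasoning

  leftChild-mono-< : a * d < c * b → a * (c + d) < c * (a + b)
  leftChild-mono-< h = begin-strict
    a * (c + d)    ≡⟨ *-distribˡ-+ a c d ⟩
    a * c + a * d  <⟨ +-monoʳ-< (a * c) h ⟩
    a * c + c * b  ≡⟨ cong (_+ c * b) (*-comm a c) ⟩
    c * a + c * b  ≡⟨ *-distribˡ-+ c a b ⟨
    c * (a + b)    ∎
    where open ≤-Reasoning

  rightChild-mono-≤ : a * d ≤ c * b → (a + b) * d ≤ (c + d) * b
  rightChild-mono-≤ h = begin
    (a + b) * d    ≡⟨ *-distribʳ-+ d a b ⟩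
    a * d + b * d  ≤⟨ +-monoˡ-≤ (b * d) h ⟩
    c * b + b * d  ≡⟨ cong (λ x → c * b + x) (*-comm b d) ⟩
    c * b + d * b  ≡⟨ *-distribʳ-+ b c d ⟨
    (c + d) * b    ∎
    where open ≤-Reasoning

  rightChild-mono-< : a * d < c * b → (a + b) * d < (c + d) * b
  rightChild-mono-< h = begin-strict
    (a + b) * d    ≡⟨ *-distribʳ-+ d a b ⟩
    a * d + b * d  <⟨ +-monoˡ-< (b * d) h ⟩
    c * b + b * d  ≡⟨ cong (λ x → c * b + x) (*-comm b d) ⟩
    c * b + d * b  ≡⟨ *-distribʳ-+ b c d ⟨
    (c + d) * b    ∎
    where open ≤-Reasoning

calkinWilfSum-mono-≤ : ∀ r {a b c d} → 0 < b → 0 < d → a * d ≤ c * b → calkinWilfSum r a b ℚ.≤ calkinWilfSum r c d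
calkinWilfSum-mono-≤ zero {a} {suc b} {c} {suc d} _ _ h =
  cross-≤⇒/-≤ (+ a) (+ c) b d (subst₂ ℤ._≤_ (ℤ.pos-* a (suc d)) (ℤ.pos-* c (suc b)) (ℤ.+≤+ h))
calkinWilfSum-mono-≤ (suc r) {a} {b} {c} {d} 0<b 0<d h = ℚ.+-mono-≤
  (calkinWilfSum-mono-≤ r (<-≤-trans 0<b (m≤n+m b a)) (<-≤-trans 0<d (m≤n+m d c)) (leftChild-mono-≤ a b c d h))
  (calkinWilfSum-mono-≤ r 0<b 0<d (rightChild-mono-≤ a b c d h))

calkinWilfSum-mono-< : ∀ r {a b c d} → 0 < b → 0 < d → a * d < c * b → calkinWilfSum r a b ℚ.< calkinWilfSum r c d
calkinWilfSum-mono-< zero {a} {suc b} {c} {suc d} _ _ h =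
  cross-<⇒/-< (+ a) (+ c) b d (subst₂ ℤ._<_ (ℤ.pos-* a (suc d)) (ℤ.pos-* c (suc b)) (ℤ.+<+ h))
calkinWilfSum-mono-< (suc r) {a} {b} {c} {d} 0<b 0<d h = ℚ.+-mono-<
  (calkinWilfSum-mono-< r (<-≤-trans 0<b (m≤n+m b a)) (<-≤-trans 0<d (m≤n+m d c)) (leftChild-mono-< a b c d h))
  (calkinWilfSum-mono-< r 0<b 0<d (rightChild-mono-< a b c d h))

Ã≡calkinWilfSum : ∀ r → Ã r ≡ calkinWilfSum r 0 1
Ã≡calkinWilfSum r = trans (cong (λ a → sumFrom a (2 ^ r) t) (sym (*-zeroʳ (2 ^ r)))) (sumFrom-t-block r 0)

A≡calkinWilfSum : ∀ r → A r ≡ calkinWilfSum r 1 1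
A≡calkinWilfSum r = trans (cong (λ a → sumFrom a (2 ^ r) t) (sym (*-identityʳ (2 ^ r)))) (sumFrom-t-block r 1)

lemma3p2 : (m r : ℕ) → 2 ∣ m →
    (Ã r ℚ.≤ sumFrom (2 ^ r * m) (2 ^ r) t) × (sumFrom (2 ^ r * m) (2 ^ r) t ℚ.< A r)
lemma3p2 m r (divides q refl) = lower , upper
  where
  b : ℕ
  b = s q + s (suc q)
  0<b : 0 < b
  0<b = <-≤-trans (s-suc-positive q) (m≤n+m _ (s q))
  block : sumFrom (2 ^ r * (q * 2)) (2 ^ r) t ≡ calkinWilfSum r (s q) b
  block = trans (sumFrom-t-block r (q * 2)) (cong₂ (calkinWilfSum r) (s-even q) (s-odd q))
  s[q]<b : s q * 1 < 1 * b
  s[q]<b = subst₂ _<_ (sym (*-identityʳ (s q))) (sym (*-identityˡ b)) (m<m+n (s q) (s-suc-positive q))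
  lower : Ã r ℚ.≤ sumFrom (2 ^ r * (q * 2)) (2 ^ r) t
  lower = subst₂ ℚ._≤_ (sym (Ã≡calkinWilfSum r)) (sym block) (calkinWilfSum-mono-≤ r ≤-refl 0<b z≤n)
  upper : sumFrom (2 ^ r * (q * 2)) (2 ^ r) t ℚ.< A r
  upper = subst₂ ℚ._<_ (sym block) (sym (A≡calkinWilfSum r)) (calkinWilfSum-mono-< r 0<b ≤-refl s[q]<b)
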